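{- Let $n=p_1^{n_1}\cdots p_r^{n_r}$ with $r\geq 3$, primes $p_1<\cdots<p_r$ and positive integers $n_i$. Then $\beta_r^1<\beta_1^{n_1}$. As a consequence, $\kappa(\mathcal{P}(C_n))<\beta_1^{n_1}$, and so $Z_1^{n_1}$ is never a minimum cut-set of $\mathcal{P}(C_n)$.
   Context: $[m]=\{1,\dots,m\}$, $\phi$ is Euler's totient function, $C_n$ is the cyclic group of order $n$. The power graph $\mathcal{P}(C_n)$ has vertex set $C_n$, two distinct vertices adjacent iff one is a power of the other. A cut-set is a vertex subset whose removal leaves a disconnected induced subgraph; a minimum cut-set is one of least size; $\kappa$ denotes vertex connectivity. For $d\mid n$, $E_d$ is the set of elements of order $d$ in $C_n$ and $S_d$ the subgroup of order $d$. For $a\in[r]$, $s\in[n_a]$: $Q_a^s=\bigcup_{i\in[r]\setminus\{a\}} S_{n/(p_ip_a^s)}$, $Z_a^s:=E_n\cup E_{n/p_a}\cup\cdots\cup E_{n/p_a^{s-1}}\cup Q_a^s$ (a cut-set of size $\beta_a^s$), and $$\beta_a^s:=\phi(n)+\frac{n}{p_1\cdots p_r}\cdot\frac{1}{p_a^{s-1}}\left[\frac{p_1\cdots p_r}{p_a}+\phi\left(\frac{p_1\cdots p_r}{p_a}\right)(p_a^{s-1}-2)\right].$$ -}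

module Defs where

open import Data.Nat as ℕ using (ℕ; zero; suc; _^_; _∸_; _≟_; _≡ᵇ_)
open import Data.Nat.DivMod as DM using ()
open import Data.Nat.Divisibility using (_∣?_)
open import Data.Nat.GCD using (gcd)
open import Data.Integer as ℤ using (ℤ; +_)
open import Data.Bool using (Bool; true; false; _∨_; _∧_; not)
open import Data.List using (List; upTo; applyUpTo; filter; length)
open import Data.Bool.ListAction using (any)
open import Data.Fin using (Fin; toℕ)
open import Data.Fin.Subset using (Subset; _∉_; ∣_∣)
open import Data.Vec using (tabulate)
open import Data.Product using (Σ; Σ-syntax; _×_)
open import Data.Sum using (_⊎_)
open import Relation.Nullary using (¬_; Dec)
open import Relation.Nullary.Decidable using (⌊_⌋)
open import Relation.Binary.PropositionalEquality using (_≡_; _≢_)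

prodR : (ℕ → ℕ) → ℕ → ℕ
prodR f zero    = 1
prodR f (suc r) = prodR f r ℕ.* f (suc r)

-- total division / remainder (value 0 / m for divisor 0; only used with nonzero divisors)
_div_ : ℕ → ℕ → ℕ
m div zero    = 0
m div (suc d) = m DM./ suc d

_mod_ : ℕ → ℕ → ℕ
m mod zero    = m
m mod (suc d) = m DM.% suc d

φ : ℕ → ℕ
φ m = length (filter (λ k → gcd k m ≟ 1) (applyUpTo suc m))

N : (p e : ℕ → ℕ) → ℕ → ℕ
N p e r = prodR (λ i → p i ^ e i) r

rad : (p : ℕ → ℕ) → ℕ → ℕ
rad p r = prodR p r

β : (p e : ℕ → ℕ) (r a s : ℕ) → ℤ
β p e r a s =
  + φ n ℤ.+ (+ (n div (P ℕ.* p a ^ (s ∸ 1))))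
            ℤ.* (+ (P div p a) ℤ.+ (+ φ (P div p a)) ℤ.* ((+ (p a ^ (s ∸ 1))) ℤ.- + 2))
  where
    n = N p e r
    P = rad p r

-- The cyclic group C_n, realised additively as Z/nZ with elements Fin n
-- (generator 1).  x is a power of y iff x = k·y for some k.
IsPowerOf : (n : ℕ) → Fin n → Fin n → Set
IsPowerOf n x y = Σ ℕ λ k → toℕ x ≡ (k ℕ.* toℕ y) mod n

Adj : (n : ℕ) → Fin n → Fin n → Set
Adj n x y = x ≢ y × (IsPowerOf n x y ⊎ IsPowerOf n y x)

ord : (n : ℕ) → Fin n → ℕ
ord n x = n div gcd (toℕ x) n

-- paths in the induced subgraph P(C_n) − X (the start vertex is assumed outside X)
data Path (n : ℕ) (X : Subset n) : Fin n → Fin n → Set where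
  here : ∀ {u} → Path n X u u
  step : ∀ {u v w} → Adj n u v → v ∉ X → Path n X v w → Path n X u w

IsCutSet : (n : ℕ) → Subset n → Set
IsCutSet n X = Σ[ u ∈ Fin n ] Σ[ v ∈ Fin n ] (u ∉ X × v ∉ X × ¬ Path n X u v)

IsMinCutSet : (n : ℕ) → Subset n → Set
IsMinCutSet n X = IsCutSet n X × (∀ Y → IsCutSet n Y → ∣ X ∣ ℕ.≤ ∣ Y ∣)

-- membership test for Z_a^s = E_n ∪ E_{n/p_a} ∪ ⋯ ∪ E_{n/p_a^{s-1}} ∪ Q_a^s,
-- Q_a^s = ⋃_{i ∈ [r] ∖ {a}} S_{n/(p_i p_a^s)};  x ∈ S_d iff ord x ∣ d.
inZ : (p e : ℕ → ℕ) (r a s : ℕ) → Fin (N p e r) → Bool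
inZ p e r a s x =
  any (λ j → ord n x ≡ᵇ (n div (p a ^ j))) (upTo s)
  ∨ any (λ i → not (i ≡ᵇ a) ∧ ⌊ ord n x ∣? (n div (p i ℕ.* p a ^ s)) ⌋) (applyUpTo suc r)
  where n = N p e r

Z : (p e : ℕ → ℕ) (r a s : ℕ) → Subset (N p e r)
Z p e r a s = tabulate (inZ p e r a s)

module Submission where

-- Write P = p₁⋯p_r and T = n/P.  The set X₀ = Z_r^1 (the units, together with the multiples of p_r having
-- another prime factor) separates p_r from p₁ in P(C_n), and counting it gives |X₀| = φ(n) + T·X = β_r^1
-- with X = P/p_r − φ(P/p_r).  The set Z_1^{n₁} contains the elements of order n/p₁^j (j < n₁) and the
-- multiples of p₁^{n₁} with another prime factor; these number β_1^{n₁} = φ(n) + t·(Y + φ(P/p₁)(q − 1)),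
-- where q = p₁^{n₁−1}, t = n/(Pq) and Y = P/p₁ − φ(P/p₁).  As T = q·t, the inequality β_r^1 < β_1^{n₁}
-- reduces to q·X < Y + φ(P/p₁)(q − 1), which follows from X < Y (because p₁ < p_r) and from
-- X ≤ P/p_r ≤ φ(P/p₁) (because p_i ≤ p_{i+1} − 1).  Finally a minimum cut-set exists by finite search
-- and has at most |X₀| < β_1^{n₁} ≤ |Z_1^{n₁}| elements.

open import Defs
open import Algebra.Properties.CommutativeSemigroup using (interchange)
open import Data.Nat as ℕ using (ℕ; zero; suc; _+_; _*_; _∸_; _^_; _≤_; _<_; z≤n; s≤s; NonZero; _≟_; _<?_; >-nonZero; >-nonZero⁻¹; nonTrivial⇒n>1)
open import Data.Nat.Properties
open import Data.Nat.Divisibility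
open import Data.Nat.DivMod using (_%_; m%n<n; m%n%n≡m%n; %-distribˡ-*; m*n/n≡m)
open import Data.Nat.GCD using (gcd; gcd-identityˡ; gcd[m,n]∣m; gcd[m,n]∣n; gcd-greatest; c*gcd[m,n]≡gcd[cm,cn])
open import Data.Nat.Coprimality as Coprimality using (Coprime; coprime-divisor)
open import Data.Nat.Primality using (Prime; prime⇒irreducible; prime⇒nonZero; prime⇒nonTrivial)
open import Data.Nat.Induction using (<-wellFounded)
open import Data.Nat.Tactic.RingSolver using (solve-∀)
open import Data.Integer as ℤ using (+_)
open import Data.Integer.Properties as ℤₚ using (pos-+; pos-*)
import Data.Integer.Tactic.RingSolver as ℤ-Solver
import Data.Bool as Bool
open import Data.Bool.Properties using (T-≡; T-∨)
open import Data.Bool.ListAction using (any)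
open import Data.List using (List; _∷_; length; filter; applyUpTo; upTo)
open import Data.List.Properties using (length-filter; length-applyUpTo)
open import Data.List.Membership.Propositional using (lose)
open import Data.List.Membership.Propositional.Properties using (∈-upTo⁺; ∈-applyUpTo⁺)
open import Data.List.Relation.Unary.Any.Properties using (any⁺)
open import Data.Fin as Fin using (Fin; toℕ; fromℕ<)
open import Data.Fin.Properties using (any?; all?; toℕ-fromℕ<)
open import Data.Fin.Subset using (Subset; _∈_; _∉_; _⊆_; ∣_∣)
open import Data.Fin.Subset.Properties using (_∈?_; anySubset?; p⊆q⇒∣p∣≤∣q∣)
open import Data.Vec using (tabulate) renaming (_∷_ to _∷ᵛ_)
open import Data.Vec.Properties using (lookup∘tabulate; lookup⇒[]=; []=⇒lookup)
open import Data.Product using (Σ-syntax; _×_; _,_; proj₁; proj₂; swap)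
open import Data.Product.Function.NonDependent.Propositional using (_×-⇔_)
open import Data.Sum using (_⊎_; inj₁; inj₂; [_,_]; [_,_]′)
open import Function.Base using (_∘_; const; id; case_of_)
open import Function.Bundles using (_⇔_; mk⇔; Equivalence)
import Function.Properties.Equivalence as ⇔
open import Function.Related.TypeIsomorphisms using (→-cong-⇔)
open import Induction.WellFounded using (Acc; acc)
open import Level using (Level; 0ℓ)
open import Relation.Nullary using (¬_; Dec; yes; no; does; contradiction; ¬?)
open import Relation.Nullary.Decidable as Dec using (_×-dec_; _⊎-dec_; _→-dec_; decidable-stable; fromWitness; ⌊_⌋)
open import Relation.Nullary.Decidable.Core using (¬¬-excluded-middle)
open import Relation.Unary using (Pred; Decidable; _∩_; _∪_; ∁)
open import Relation.Unary.Properties using (_∩?_; _∪?_; ∁?)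
open import Relation.Binary.Definitions using (tri<; tri≈; tri>)
open import Relation.Binary.PropositionalEquality using (_≡_; _≢_; refl; sym; trans; cong; cong₂; subst; subst₂; module ≡-Reasoning)

module Counting where

  private
    variable
      ℓ ℓ′ : Level
      A B : Set ℓ
      P Q D : Pred ℕ ℓ

  indicator : Dec A → ℕ
  indicator (yes _) = 1
  indicator (no _)  = 0

  indicator-cong : A ⇔ B → (a? : Dec A) (b? : Dec B) → indicator a? ≡ indicator b?
  indicator-cong A⇔B (yes a) (yes b) = refl
  indicator-cong A⇔B (yes a) (no ¬b) = contradiction (Equivalence.to A⇔B a) ¬b
  indicator-cong A⇔B (no ¬a) (yes b) = contradiction (Equivalence.from A⇔B b) ¬a
  indicator-cong A⇔B (no ¬a) (no ¬b) = refl

  count : Decidable P → ℕ → ℕ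
  count P? zero    = 0
  count P? (suc m) = count P? m + indicator (P? m)

  count-cong : (P? : Decidable P) (Q? : Decidable Q) (m : ℕ) →
               (∀ x → x < m → P x ⇔ Q x) → count P? m ≡ count Q? m
  count-cong P? Q? zero    P⇔Q = refl
  count-cong P? Q? (suc m) P⇔Q = cong₂ _+_
    (count-cong P? Q? m (λ x x<m → P⇔Q x (m<n⇒m<1+n x<m)))
    (indicator-cong (P⇔Q m (n<1+n m)) (P? m) (Q? m))

  count-all : (P? : Decidable P) (m : ℕ) → (∀ x → x < m → P x) → count P? m ≡ m
  count-all P? zero    all = refl
  count-all P? (suc m) all with P? m
  ... | yes _  = trans (cong (_+ 1) (count-all P? m (λ x x<m → all x (m<n⇒m<1+n x<m)))) (+-comm m 1)
  ... | no ¬Pm = contradiction (all m (n<1+n m)) ¬Pm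

  count-none : (P? : Decidable P) (m : ℕ) → (∀ x → x < m → ¬ P x) → count P? m ≡ 0
  count-none P? zero    none = refl
  count-none P? (suc m) none with P? m
  ... | yes Pm = contradiction Pm (none m (n<1+n m))
  ... | no _   = trans (+-identityʳ _) (count-none P? m (λ x x<m → none x (m<n⇒m<1+n x<m)))

  count-+ : (P? : Decidable P) (a b : ℕ) → count P? (a + b) ≡ count P? a + count (λ x → P? (a + x)) b
  count-+ P? a zero    = trans (cong (count P?) (+-identityʳ a)) (sym (+-identityʳ _))
  count-+ P? a (suc b) = begin
    count P? (a + suc b)                                             ≡⟨ cong (count P?) (+-suc a b) ⟩
    count P? (a + b) + indicator (P? (a + b))                        ≡⟨ cong (_+ indicator (P? (a + b))) (count-+ P? a b) ⟩
    count P? a + count (λ x → P? (a + x)) b + indicator (P? (a + b)) ≡⟨ +-assoc (count P? a) _ _ ⟩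
    count P? a + count (λ x → P? (a + x)) (suc b)                    ∎
    where open ≡-Reasoning

  count-suc : (P? : Decidable P) (m : ℕ) → count P? (suc m) ≡ indicator (P? 0) + count (λ x → P? (suc x)) m
  count-suc P? m = count-+ P? 1 m

  count-∪ : (P? : Decidable P) (Q? : Decidable Q) (m : ℕ) → (∀ x → x < m → P x → ¬ Q x) →
            count (P? ∪? Q?) m ≡ count P? m + count Q? m
  count-∪ P? Q? zero    disjoint = refl
  count-∪ {P = P} {Q = Q} P? Q? (suc m) disjoint = begin
    count (P? ∪? Q?) m + indicator ((P? ∪? Q?) m)
      ≡⟨ cong₂ _+_ (count-∪ P? Q? m (λ x x<m → disjoint x (m<n⇒m<1+n x<m))) (indicator-⊎ (P? m) (Q? m)) ⟩
    count P? m + count Q? m + (indicator (P? m) + indicator (Q? m))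
      ≡⟨ interchange +-commutativeSemigroup (count P? m) _ _ _ ⟩
    count P? m + indicator (P? m) + (count Q? m + indicator (Q? m)) ∎
    where
    open ≡-Reasoning
    indicator-⊎ : (a? : Dec (P m)) (b? : Dec (Q m)) → indicator (a? ⊎-dec b?) ≡ indicator a? + indicator b?
    indicator-⊎ (yes a) (yes b) = contradiction b (disjoint m (n<1+n m) a)
    indicator-⊎ (yes a) (no _)  = refl
    indicator-⊎ (no _)  (yes b) = refl
    indicator-⊎ (no _)  (no _)  = refl

  count-∩-∁ : (D? : Decidable D) (P? : Decidable P) (m : ℕ) →
              count (D? ∩? P?) m + count (∁? D? ∩? P?) m ≡ count P? m
  count-∩-∁ {D = D} {P = P} D? P? m = begin
    count (D? ∩? P?) m + count (∁? D? ∩? P?) m ≡⟨ count-∪ (D? ∩? P?) (∁? D? ∩? P?) m (λ _ _ (Dx , _) (¬Dx , _) → ¬Dx Dx) ⟨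
    count ((D? ∩? P?) ∪? (∁? D? ∩? P?)) m      ≡⟨ count-cong _ P? m (λ x _ → mk⇔ [ proj₂ , proj₂ ] (split x)) ⟩
    count P? m                                 ∎
    where
    open ≡-Reasoning
    split : ∀ x → P x → (D ∩ P) x ⊎ (∁ D ∩ P) x
    split x Px with D? x
    ... | yes Dx = inj₁ (Dx , Px)
    ... | no ¬Dx = inj₂ (¬Dx , Px)

  count-∁ : (P? : Decidable P) (m : ℕ) → count (∁? P?) m ≡ m ∸ count P? m
  count-∁ {P = P} P? m = begin
    count (∁? P?) m                           ≡⟨ m+n∸n≡m _ (count P? m) ⟨
    count (∁? P?) m + count P? m ∸ count P? m ≡⟨ cong (_∸ count P? m) (count-∪ (∁? P?) P? m (λ _ _ ¬Px Px → ¬Px Px)) ⟨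
    count (∁? P? ∪? P?) m ∸ count P? m        ≡⟨ cong (_∸ count P? m) (count-all (∁? P? ∪? P?) m excluded-middle) ⟩
    m ∸ count P? m                            ∎
    where
    open ≡-Reasoning
    excluded-middle : ∀ x → x < m → (∁ P ∪ P) x
    excluded-middle x _ with P? x
    ... | yes Px = inj₂ Px
    ... | no ¬Px = inj₁ ¬Px

  count-multiples : (d : ℕ) .{{_ : NonZero d}} (P? : Decidable P) (k : ℕ) →
                    count ((d ∣?_) ∩? P?) (d * k) ≡ count (λ y → P? (d * y)) k
  count-multiples d P? zero    = count-none ((d ∣?_) ∩? P?) (d * 0) (λ x x<d*0 → contradiction (subst (x <_) (*-zeroʳ d) x<d*0) λ ())
  count-multiples {P = P} d@(suc d′) P? (suc k) = begin
    count M? (d * suc k)                                        ≡⟨ cong (count M?) (trans (*-suc d k) (+-comm d (d * k))) ⟩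
    count M? (d * k + d)                                        ≡⟨ count-+ M? (d * k) d ⟩
    count M? (d * k) + count (λ x → M? (d * k + x)) (suc d′)    ≡⟨ cong₂ _+_ (count-multiples d P? k) (count-suc (λ x → M? (d * k + x)) d′) ⟩
    count (λ y → P? (d * y)) k + (indicator (M? (d * k + 0)) + count (λ x → M? (d * k + suc x)) d′)
      ≡⟨ cong (λ c → count (λ y → P? (d * y)) k + (indicator (M? (d * k + 0)) + c))
              (count-none _ d′ (λ x x<d′ → not-multiple x x<d′ ∘ proj₁)) ⟩
    count (λ y → P? (d * y)) k + (indicator (M? (d * k + 0)) + 0)
      ≡⟨ cong (_+_ (count (λ y → P? (d * y)) k)) (trans (+-identityʳ _) (indicator-cong block-start (M? (d * k + 0)) (P? (d * k)))) ⟩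
    count (λ y → P? (d * y)) (suc k)                            ∎
    where
    open ≡-Reasoning
    M? : Decidable ((d ∣_) ∩ P)
    M? = (d ∣?_) ∩? P?
    not-multiple : ∀ x → x < d′ → ¬ d ∣ d * k + suc x
    not-multiple x x<d′ d∣ = <-irrefl refl (≤-<-trans (∣⇒≤ (∣m+n∣m⇒∣n d∣ (m∣m*n k))) (s≤s x<d′))
    block-start : (d ∣ d * k + 0 × P (d * k + 0)) ⇔ P (d * k)
    block-start rewrite +-identityʳ (d * k) = mk⇔ proj₂ (m∣m*n k ,_)

  count-multiples-invariant : (d : ℕ) .{{_ : NonZero d}} (P? : Decidable P) (k : ℕ) → (∀ y → P (d * y) ⇔ P y) →
                              count ((d ∣?_) ∩? P?) (d * k) ≡ count P? k
  count-multiples-invariant d P? k invariant = trans (count-multiples d P? k) (count-cong _ P? k (λ y _ → invariant y))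

  count-non-multiples-invariant : (d : ℕ) .{{_ : NonZero d}} (P? : Decidable P) (k : ℕ) → (∀ y → P (d * y) ⇔ P y) →
                                  count (∁? (d ∣?_) ∩? P?) (d * k) ≡ count P? (d * k) ∸ count P? k
  count-non-multiples-invariant d P? k invariant = begin
    count (∁? (d ∣?_) ∩? P?) (d * k)                                                        ≡⟨ m+n∸m≡n (count ((d ∣?_) ∩? P?) (d * k)) _ ⟨
    count ((d ∣?_) ∩? P?) (d * k) + count (∁? (d ∣?_) ∩? P?) (d * k) ∸ count ((d ∣?_) ∩? P?) (d * k)
      ≡⟨ cong₂ _∸_ (count-∩-∁ (d ∣?_) P? (d * k)) (count-multiples-invariant d P? k invariant) ⟩
    count P? (d * k) ∸ count P? k                                                           ∎
    where open ≡-Reasoning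

  ∣tabulate∣ : ∀ {n} (P? : Decidable P) → ∣ tabulate {n = n} (λ i → does (P? (toℕ i))) ∣ ≡ count P? n
  ∣tabulate∣ {n = zero}  P? = refl
  ∣tabulate∣ {n = suc n} P? = trans (∣∷∣ (P? 0) (tabulate {n = n} (λ i → does (P? (suc (toℕ i))))))
    (trans (cong (_+_ (indicator (P? 0))) (∣tabulate∣ {n = n} (λ x → P? (suc x)))) (sym (count-suc P? n)))
    where
    ∣∷∣ : ∀ {k} (a? : Dec A) (p : Subset k) → ∣ does a? ∷ᵛ p ∣ ≡ indicator a? + ∣ p ∣
    ∣∷∣ (yes _) p = refl
    ∣∷∣ (no _)  p = refl

  ∈-tabulate⁺ : ∀ {n} {f : Fin n → Bool.Bool} {i} → f i ≡ Bool.true → i ∈ tabulate f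
  ∈-tabulate⁺ {f = f} {i} fi = lookup⇒[]= i (tabulate f) (trans (lookup∘tabulate f i) fi)

  ∈-tabulate⁻ : ∀ {n} {f : Fin n → Bool.Bool} {i} → i ∈ tabulate f → f i ≡ Bool.true
  ∈-tabulate⁻ {f = f} {i} i∈ = trans (sym (lookup∘tabulate f i)) ([]=⇒lookup i∈)

  does≡true⇔ : (a? : Dec A) → does a? ≡ Bool.true ⇔ A
  does≡true⇔ (yes a) = mk⇔ (const a) (const refl)
  does≡true⇔ (no ¬a) = mk⇔ (λ ()) (λ a → contradiction a ¬a)

  count≤∣tabulate∣ : ∀ {n} (P? : Decidable P) (f : Fin n → Bool.Bool) →
                     (∀ i → P (toℕ i) → Bool.T (f i)) → count P? n ≤ ∣ tabulate f ∣
  count≤∣tabulate∣ {n = n} P? f P⇒f = begin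
    count P? n                                     ≡⟨ ∣tabulate∣ {n = n} P? ⟨
    ∣ tabulate {n = n} (λ i → does (P? (toℕ i))) ∣ ≤⟨ p⊆q⇒∣p∣≤∣q∣ P⊆f ⟩
    ∣ tabulate f ∣                                 ∎
    where
    open ≤-Reasoning
    P⊆f : tabulate (λ i → does (P? (toℕ i))) ⊆ tabulate f
    P⊆f {i} = ∈-tabulate⁺ ∘ Equivalence.to T-≡ ∘ P⇒f i ∘ Equivalence.to (does≡true⇔ (P? (toℕ i))) ∘ ∈-tabulate⁻

  length-filter-∷ : {P : Pred A ℓ′} (P? : Decidable P) (x : A) (xs : List A) →
                    length (filter P? (x ∷ xs)) ≡ indicator (P? x) + length (filter P? xs)
  length-filter-∷ P? x xs with P? x
  ... | yes _ = refl
  ... | no _  = refl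

  length-filter-applyUpTo : (P? : Decidable P) (f : ℕ → ℕ) (m : ℕ) →
                            length (filter P? (applyUpTo f m)) ≡ count (λ x → P? (f x)) m
  length-filter-applyUpTo P? f zero    = refl
  length-filter-applyUpTo P? f (suc m) = begin
    length (filter P? (applyUpTo f (suc m)))                          ≡⟨ length-filter-∷ P? (f 0) (applyUpTo (f ∘ suc) m) ⟩
    indicator (P? (f 0)) + length (filter P? (applyUpTo (f ∘ suc) m)) ≡⟨ cong (_+_ (indicator (P? (f 0)))) (length-filter-applyUpTo P? (f ∘ suc) m) ⟩
    indicator (P? (f 0)) + count (λ x → P? (f (suc x))) m             ≡⟨ count-suc (λ x → P? (f x)) m ⟨
    count (λ x → P? (f x)) (suc m)                                    ∎
    where open ≡-Reasoning

  -- φ counts 1 ≤ k ≤ m and count counts 0 ≤ k < m; the end points agree as gcd 0 m = m = gcd m m.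
  φ≡count : (m : ℕ) → φ m ≡ count (λ k → gcd k m ≟ 1) m
  φ≡count m = +-cancelˡ-≡ (indicator (coprime? 0)) _ _ (begin
    indicator (coprime? 0) + φ m                              ≡⟨ cong (_+_ (indicator (coprime? 0))) (length-filter-applyUpTo coprime? suc m) ⟩
    indicator (coprime? 0) + count (λ k → coprime? (suc k)) m ≡⟨ count-suc coprime? m ⟨
    count coprime? m + indicator (coprime? m)                 ≡⟨ +-comm (count coprime? m) _ ⟩
    indicator (coprime? m) + count coprime? m                 ≡⟨ cong (λ g → indicator (g ≟ 1) + count coprime? m) gcd[m,m]≡gcd[0,m] ⟩
    indicator (coprime? 0) + count coprime? m                 ∎)
    where
    open ≡-Reasoning
    coprime? : Decidable (λ k → gcd k m ≡ 1)
    coprime? k = gcd k m ≟ 1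
    gcd[m,m]≡gcd[0,m] : gcd m m ≡ gcd 0 m
    gcd[m,m]≡gcd[0,m] = trans (∣-antisym (gcd[m,n]∣m m m) (gcd-greatest ∣-refl ∣-refl)) (sym (gcd-identityˡ m))

  φ[m]≤m : ∀ m → φ m ≤ m
  φ[m]≤m m = ≤-trans (length-filter _ (applyUpTo suc m)) (≤-reflexive (length-applyUpTo suc m))

open Counting

prodR-head : ∀ f k → prodR f (suc k) ≡ f 1 * prodR (f ∘ suc) k
prodR-head f zero    = trans (*-identityˡ (f 1)) (sym (*-identityʳ (f 1)))
prodR-head f (suc k) = trans (cong (_* f (suc (suc k))) (prodR-head f k)) (*-assoc (f 1) _ _)

prodR-* : ∀ f g k → prodR (λ i → f i * g i) k ≡ prodR f k * prodR g k
prodR-* f g zero    = refl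
prodR-* f g (suc k) = trans (cong (_* (f (suc k) * g (suc k))) (prodR-* f g k))
                            (interchange *-commutativeSemigroup (prodR f k) (prodR g k) (f (suc k)) (g (suc k)))

prodR-cong : ∀ {f g} k → (∀ i → 1 ≤ i → i ≤ k → f i ≡ g i) → prodR f k ≡ prodR g k
prodR-cong zero    f≗g = refl
prodR-cong (suc k) f≗g = cong₂ _*_ (prodR-cong k (λ i 1≤i i≤k → f≗g i 1≤i (m≤n⇒m≤1+n i≤k))) (f≗g (suc k) (s≤s z≤n) ≤-refl)

prodR-mono-≤ : ∀ {f g} k → (∀ i → 1 ≤ i → i ≤ k → f i ≤ g i) → prodR f k ≤ prodR g k
prodR-mono-≤ zero    f≤g = ≤-refl
prodR-mono-≤ (suc k) f≤g = *-mono-≤ (prodR-mono-≤ k (λ i 1≤i i≤k → f≤g i 1≤i (m≤n⇒m≤1+n i≤k))) (f≤g (suc k) (s≤s z≤n) ≤-refl)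

prodR-positive : ∀ {f} k → (∀ i → 1 ≤ i → i ≤ k → 0 < f i) → 0 < prodR f k
prodR-positive zero    _   = s≤s z≤n
prodR-positive (suc k) f>0 = *-mono-≤ (prodR-positive k (λ i 1≤i i≤k → f>0 i 1≤i (m≤n⇒m≤1+n i≤k))) (f>0 (suc k) (s≤s z≤n) ≤-refl)

prodR-pred<prodR : ∀ {f} k → (∀ i → 1 ≤ i → i ≤ suc k → 0 < f i) → prodR (λ i → f i ∸ 1) (suc k) < prodR f (suc k)
prodR-pred<prodR {f} k f>0 = begin-strict
  prodR (λ i → f i ∸ 1) k * (f (suc k) ∸ 1) ≤⟨ *-monoˡ-≤ (f (suc k) ∸ 1) (prodR-mono-≤ k (λ i _ _ → m∸n≤m (f i) 1)) ⟩
  prodR f k * (f (suc k) ∸ 1)               <⟨ *-monoʳ-< (prodR f k) (∸-monoʳ-< {o = 0} (s≤s z≤n) (f>0 (suc k) (s≤s z≤n) ≤-refl)) ⟩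
  prodR f k * f (suc k)                     ∎
  where
  open ≤-Reasoning
  instance
    prodR-nonZero : NonZero (prodR f k)
    prodR-nonZero = >-nonZero (prodR-positive k (λ i 1≤i i≤k → f>0 i 1≤i (m≤n⇒m≤1+n i≤k)))

∣-prodR : ∀ f k i → 1 ≤ i → i ≤ k → f i ∣ prodR f k
∣-prodR f zero    i 1≤i i≤0 = contradiction (≤-trans 1≤i i≤0) λ ()
∣-prodR f (suc k) i 1≤i i≤1+k with i ≟ suc k
... | yes refl  = n∣m*n (prodR f k)
... | no  i≢1+k = ∣m⇒∣m*n (f (suc k)) (∣-prodR f k i 1≤i (≤-pred (≤∧≢⇒< i≤1+k i≢1+k)))

prodR-pow-split : (p e : ℕ → ℕ) (k : ℕ) → (∀ i → 1 ≤ i → i ≤ k → 1 ≤ e i) →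
                  prodR (λ i → p i ^ e i) k ≡ prodR (λ i → p i ^ (e i ∸ 1)) k * prodR p k
prodR-pow-split p e k e≥1 = trans (prodR-cong k (λ i 1≤i i≤k → pow-split (p i) (e≥1 i 1≤i i≤k))) (prodR-* (λ i → p i ^ (e i ∸ 1)) p k)
  where
  pow-split : ∀ a {d} → 1 ≤ d → a ^ d ≡ a ^ (d ∸ 1) * a
  pow-split a {suc d} _ = *-comm a (a ^ d)

bounded-∀-suc⇔ : ∀ {ℓ} {Q : ℕ → Set ℓ} k →
                 (∀ i → 1 ≤ i → i ≤ suc k → Q i) ⇔ ((∀ i → 1 ≤ i → i ≤ k → Q i) × Q (suc k))
bounded-∀-suc⇔ k = mk⇔
  (λ ∀Q → (λ i 1≤i i≤k → ∀Q i 1≤i (m≤n⇒m≤1+n i≤k)) , ∀Q (suc k) (s≤s z≤n) ≤-refl)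
  (λ (∀Q , Q[1+k]) i 1≤i i≤1+k → case i ≟ suc k of λ where
     (yes refl) → Q[1+k]
     (no i≢1+k) → ∀Q i 1≤i (≤-pred (≤∧≢⇒< i≤1+k i≢1+k)))

bounded-∀-head⇔ : ∀ {ℓ} {Q : ℕ → Set ℓ} k →
                  (∀ i → 1 ≤ i → i ≤ suc k → Q i) ⇔ (Q 1 × (∀ i → 1 ≤ i → i ≤ k → Q (suc i)))
bounded-∀-head⇔ k = mk⇔
  (λ ∀Q → ∀Q 1 ≤-refl (s≤s z≤n) , λ i 1≤i i≤k → ∀Q (suc i) (s≤s z≤n) (s≤s i≤k))
  (λ where (Q1 , ∀Q) (suc zero)    _ _         → Q1
           (Q1 , ∀Q) (suc (suc i)) _ (s≤s i<k) → ∀Q (suc i) (s≤s z≤n) i<k)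

record IncreasingPrimes (p : ℕ → ℕ) (k : ℕ) : Set where
  constructor mkIncreasingPrimes
  field
    prime      : ∀ i → 1 ≤ i → i ≤ k → Prime (p i)
    increasing : ∀ i j → 1 ≤ i → i < j → j ≤ k → p i < p j

  init : ∀ {k′} → k′ ≤ k → IncreasingPrimes p k′
  init k′≤k = record
    { prime      = λ i 1≤i i≤k′ → prime i 1≤i (≤-trans i≤k′ k′≤k)
    ; increasing = λ i j 1≤i i<j j≤k′ → increasing i j 1≤i i<j (≤-trans j≤k′ k′≤k)
    }

  tail : ∀ {k′} → suc k′ ≡ k → IncreasingPrimes (p ∘ suc) k′
  tail refl = record
    { prime      = λ i 1≤i i≤k′ → prime (suc i) (s≤s z≤n) (s≤s i≤k′)
    ; increasing = λ i j 1≤i i<j j≤k′ → increasing (suc i) (suc j) (s≤s z≤n) (s≤s i<j) (s≤s j≤k′)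
    }

prime∣prime⇒≡ : ∀ {a b} → Prime a → Prime b → a ∣ b → a ≡ b
prime∣prime⇒≡ {a} pa pb a∣b with prime⇒irreducible pb a∣b
... | inj₂ a≡b  = a≡b
... | inj₁ refl = contradiction pa λ ()

coprime-*⇔ : ∀ {y a b} → Coprime y (a * b) ⇔ (Coprime y a × Coprime y b)
coprime-*⇔ {y} {a} {b} = mk⇔
  (λ c → (λ {_} (d∣y , d∣a) → c (d∣y , ∣m⇒∣m*n b d∣a)) , (λ {_} (d∣y , d∣b) → c (d∣y , ∣n⇒∣m*n a d∣b)))
  (λ (ca , cb) {_} (d∣y , d∣ab) → cb (d∣y , coprime-divisor (λ {_} (d′∣d , d′∣a) → ca (∣-trans d′∣d d∣y , d′∣a)) d∣ab))

coprime-^⇔ : ∀ {y a e} → 1 ≤ e → Coprime y (a ^ e) ⇔ Coprime y a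
coprime-^⇔ {y} {a} {suc e} _ = mk⇔ (proj₁ ∘ Equivalence.to coprime-*⇔) (λ ca → Equivalence.from coprime-*⇔ (ca , coprime-pow e ca))
  where
  coprime-pow : ∀ e → Coprime y a → Coprime y (a ^ e)
  coprime-pow zero    ca (_ , d∣1) = ∣1⇒≡1 d∣1
  coprime-pow (suc e) ca = Equivalence.from coprime-*⇔ (ca , coprime-pow e ca)

coprime-prime⇔ : ∀ {y p} → Prime p → Coprime y p ⇔ (¬ p ∣ y)
coprime-prime⇔ {y} {p} pp = mk⇔
  (λ c p∣y → contradiction (c (p∣y , ∣-refl)) (λ { refl → contradiction pp λ () }))
  (λ p∤y {_} (d∣y , d∣p) → [ id , (λ { refl → contradiction d∣y p∤y }) ]′ (prime⇒irreducible pp d∣p))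

coprime-prodR⇔ : ∀ {y} f k → Coprime y (prodR f k) ⇔ (∀ i → 1 ≤ i → i ≤ k → Coprime y (f i))
coprime-prodR⇔ f zero    = mk⇔ (λ _ i 1≤i i≤0 → contradiction (≤-trans 1≤i i≤0) λ ()) (λ _ {_} (_ , d∣1) → ∣1⇒≡1 d∣1)
coprime-prodR⇔ f (suc k) = ⇔.trans coprime-*⇔ (⇔.trans (coprime-prodR⇔ f k ×-⇔ ⇔.refl) (⇔.sym (bounded-∀-suc⇔ k)))

coprime-∣ʳ : ∀ {z n w} → Coprime z n → w ∣ n → Coprime z w
coprime-∣ʳ z⊥n w∣n (d∣z , d∣w) = z⊥n (d∣z , ∣-trans d∣w w∣n)

coprime-∣-* : ∀ {a b x} → Coprime a b → a ∣ x → b ∣ x → a * b ∣ x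
coprime-∣-* {a} {b} a⊥b a∣x (divides k x≡kb) =
  subst (a * b ∣_) (sym x≡kb) (*-monoˡ-∣ b (coprime-divisor a⊥b (subst (a ∣_) (trans x≡kb (*-comm k b)) a∣x)))

gcd[c*z,n]≡c : ∀ {c z n} → c ∣ n → Coprime z n → gcd (c * z) n ≡ c
gcd[c*z,n]≡c {c} {z} {n} (divides w n≡wc) z⊥n = begin
  gcd (c * z) n       ≡⟨ cong (gcd (c * z)) n≡cw ⟩
  gcd (c * z) (c * w) ≡⟨ c*gcd[m,n]≡gcd[cm,cn] c z w ⟨
  c * gcd z w         ≡⟨ cong (c *_) (Coprimality.coprime⇒gcd≡1 (coprime-∣ʳ z⊥n (divides c n≡cw))) ⟩
  c * 1               ≡⟨ *-identityʳ c ⟩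
  c                   ∎
  where
  open ≡-Reasoning
  n≡cw : n ≡ c * w
  n≡cw = trans n≡wc (*-comm w c)

^-∣-^ : ∀ a {j e} → j ≤ e → a ^ j ∣ a ^ e
^-∣-^ a {j} {e} j≤e = divides (a ^ (e ∸ j)) (trans (cong (a ^_) (sym (m+[n∸m]≡n j≤e))) (trans (^-distribˡ-+-* a j (e ∸ j)) (*-comm (a ^ j) _)))

split-prime-power : ∀ a e x → ¬ a ^ e ∣ x → Σ[ j ∈ ℕ ] (j < e × Σ[ z ∈ ℕ ] (x ≡ a ^ j * z × ¬ a ∣ z))
split-prime-power a zero    x ¬1∣x = contradiction (1∣ x) ¬1∣x
split-prime-power a (suc e) x ¬a^[1+e]∣x with a ∣? x
... | no  a∤x = 0 , s≤s z≤n , x , sym (*-identityˡ x) , a∤x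
... | yes (divides x′ x≡x′a) =
  let (j , j<e , z , x′≡a^jz , a∤z) = split-prime-power a e x′ (¬a^[1+e]∣x ∘ lift)
  in suc j , s≤s j<e , z , trans x≡x′a (trans (cong (_* a) x′≡a^jz) (reassociate (a ^ j) z a)) , a∤z
  where
  lift : a ^ e ∣ x′ → a ^ suc e ∣ x
  lift a^e∣x′ = subst₂ _∣_ (*-comm (a ^ e) a) (sym x≡x′a) (*-monoˡ-∣ a a^e∣x′)
  reassociate : ∀ b z a → b * z * a ≡ a * b * z
  reassociate = solve-∀

*-div-cancel : ∀ a b .{{_ : NonZero b}} → (a * b) div b ≡ a
*-div-cancel a (suc b) = m*n/n≡m a (suc b)

div-∣-div : ∀ {n g d} → n ≢ 0 → d ∣ g → g ∣ n → n div g ∣ n div d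
div-∣-div {n} {g} {d} n≢0 (divides b g≡bd) (divides a n≡ag) = subst₂ _∣_
  (sym (trans (cong (_div g) n≡ag) (*-div-cancel a g {{ℕ.≢-nonZero g≢0}})))
  (sym (trans (cong (_div d) (trans n≡ag (trans (cong (a *_) g≡bd) (sym (*-assoc a b d))))) (*-div-cancel (a * b) d {{ℕ.≢-nonZero d≢0}})))
  (m∣m*n b)
  where
  g≢0 : g ≢ 0
  g≢0 refl = n≢0 (trans n≡ag (*-zeroʳ a))
  d≢0 : d ≢ 0
  d≢0 refl = g≢0 (trans g≡bd (*-zeroʳ b))

Avoids : (ℕ → ℕ) → ℕ → Pred ℕ 0ℓ
Avoids p k x = ∀ i → 1 ≤ i → i ≤ k → ¬ p i ∣ x

avoids? : ∀ p k → Decidable (Avoids p k)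
avoids? p zero    x = yes (λ i 1≤i i≤0 → contradiction (≤-trans 1≤i i≤0) λ ())
avoids? p (suc k) x = Dec.map (⇔.sym (bounded-∀-suc⇔ k)) (avoids? p k x ×-dec ¬? (p (suc k) ∣? x))

¬avoids⇒∣ : ∀ p k x → ¬ Avoids p k x → Σ[ i ∈ ℕ ] (1 ≤ i × i ≤ k × p i ∣ x)
¬avoids⇒∣ p zero    x ¬avoids = contradiction (λ i 1≤i i≤0 → contradiction (≤-trans 1≤i i≤0) λ ()) ¬avoids
¬avoids⇒∣ p (suc k) x ¬avoids with p (suc k) ∣? x
... | yes p∣x = suc k , s≤s z≤n , ≤-refl , p∣x
... | no  p∤x =
  let (i , 1≤i , i≤k , pᵢ∣x) = ¬avoids⇒∣ p k x (λ avoids → ¬avoids (Equivalence.from (bounded-∀-suc⇔ k) (avoids , p∤x)))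
  in i , 1≤i , m≤n⇒m≤1+n i≤k , pᵢ∣x

avoids-*⇔ : ∀ {p k d y} → (∀ i → 1 ≤ i → i ≤ k → Coprime (p i) d) → Avoids p k (d * y) ⇔ Avoids p k y
avoids-*⇔ {d = d} coprime = mk⇔
  (λ avoids i 1≤i i≤k pᵢ∣y  → avoids i 1≤i i≤k (∣n⇒∣m*n d pᵢ∣y))
  (λ avoids i 1≤i i≤k pᵢ∣dy → avoids i 1≤i i≤k (coprime-divisor (coprime i 1≤i i≤k) pᵢ∣dy))

¬-cong : ∀ {ℓ} {A B : Set ℓ} → A ⇔ B → (¬ A) ⇔ (¬ B)
¬-cong A⇔B = →-cong-⇔ A⇔B ⇔.refl

coprime-prodR⇔avoids : ∀ {y} f p k → (∀ i → 1 ≤ i → i ≤ k → Coprime y (f i) ⇔ (¬ p i ∣ y)) →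
                       Coprime y (prodR f k) ⇔ Avoids p k y
coprime-prodR⇔avoids {y} f p k factorwise = ⇔.trans (coprime-prodR⇔ f k) (mk⇔
  (λ (c : ∀ i → 1 ≤ i → i ≤ k → Coprime y (f i)) i 1≤i i≤k → Equivalence.to (factorwise i 1≤i i≤k) (c i 1≤i i≤k))
  (λ avoids i 1≤i i≤k → Equivalence.from (factorwise i 1≤i i≤k) (avoids i 1≤i i≤k)))

coprime-prodR-pow⇔avoids : ∀ {p} (e : ℕ → ℕ) k → (∀ i → 1 ≤ i → i ≤ k → Prime (p i)) → (∀ i → 1 ≤ i → i ≤ k → 1 ≤ e i) →
                           ∀ y → Coprime y (prodR (λ i → p i ^ e i) k) ⇔ Avoids p k y
coprime-prodR-pow⇔avoids {p} e k prime e≥1 y = coprime-prodR⇔avoids (λ i → p i ^ e i) p k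
  (λ i 1≤i i≤k → ⇔.trans (coprime-^⇔ (e≥1 i 1≤i i≤k)) (coprime-prime⇔ (prime i 1≤i i≤k)))

-- Multiplication by p (k+1) preserves avoiding p 1, …, p k, so below K·p(1)⋯p(k+1) exactly K·F of the
-- numbers avoiding p 1, …, p k are multiples of p (k+1), where F = (p 1 − 1)⋯(p k − 1).
count-avoids : ∀ {p} k → IncreasingPrimes p k → ∀ K →
               count (avoids? p k) (K * prodR p k) ≡ K * prodR (λ i → p i ∸ 1) k
count-avoids         zero    _      K = count-all (avoids? _ zero) (K * 1) (λ x _ i 1≤i i≤0 → contradiction (≤-trans 1≤i i≤0) λ ())
count-avoids {p = p} (suc k) primes K = begin
  count (avoids? p (suc k)) (K * (Pₖ * a))
    ≡⟨ count-cong _ (∁? (a ∣?_) ∩? avoids? p k) (K * (Pₖ * a)) (λ x _ → ⇔.trans (bounded-∀-suc⇔ k) (mk⇔ swap swap)) ⟩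
  count (∁? (a ∣?_) ∩? avoids? p k) (K * (Pₖ * a))
    ≡⟨ cong (count (∁? (a ∣?_) ∩? avoids? p k)) (reorder K Pₖ a) ⟩
  count (∁? (a ∣?_) ∩? avoids? p k) (a * (K * Pₖ))
    ≡⟨ count-non-multiples-invariant a (avoids? p k) (K * Pₖ) (λ y → avoids-*⇔ pᵢ⊥a) ⟩
  count (avoids? p k) (a * (K * Pₖ)) ∸ count (avoids? p k) (K * Pₖ)
    ≡⟨ cong₂ _∸_ (trans (cong (count (avoids? p k)) (sym (*-assoc a K Pₖ))) (count-avoids k primesₖ (a * K))) (count-avoids k primesₖ K) ⟩
  a * K * Fₖ ∸ K * Fₖ
    ≡⟨ cong₂ _∸_ (*-assoc a K Fₖ) (sym (*-identityˡ (K * Fₖ))) ⟩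
  a * (K * Fₖ) ∸ 1 * (K * Fₖ)
    ≡⟨ *-distribʳ-∸ (K * Fₖ) a 1 ⟨
  (a ∸ 1) * (K * Fₖ)
    ≡⟨ reorder′ (a ∸ 1) K Fₖ ⟩
  K * (Fₖ * (a ∸ 1)) ∎
  where
  open ≡-Reasoning
  open IncreasingPrimes primes
  a Pₖ Fₖ : ℕ
  a  = p (suc k)
  Pₖ = prodR p k
  Fₖ = prodR (λ i → p i ∸ 1) k
  instance
    a-nonZero : NonZero a
    a-nonZero = prime⇒nonZero (prime (suc k) (s≤s z≤n) ≤-refl)
  primesₖ : IncreasingPrimes p k
  primesₖ = init (n≤1+n k)
  pᵢ⊥a : ∀ i → 1 ≤ i → i ≤ k → Coprime (p i) a
  pᵢ⊥a i 1≤i i≤k = Equivalence.from (coprime-prime⇔ (prime (suc k) (s≤s z≤n) ≤-refl)) a∤pᵢ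
    where
    a∤pᵢ : ¬ a ∣ p i
    a∤pᵢ a∣pᵢ = <⇒≢ (increasing i (suc k) 1≤i (s≤s i≤k) ≤-refl)
                   (sym (prime∣prime⇒≡ (prime (suc k) (s≤s z≤n) ≤-refl) (prime i 1≤i (m≤n⇒m≤1+n i≤k)) a∣pᵢ))
  reorder : ∀ K P a → K * (P * a) ≡ a * (K * P)
  reorder = solve-∀
  reorder′ : ∀ b K F → b * (K * F) ≡ K * (F * b)
  reorder′ = solve-∀

φ≡count-avoids : ∀ {m p k} → (∀ y → Coprime y m ⇔ Avoids p k y) → φ m ≡ count (avoids? p k) m
φ≡count-avoids {m} {p} {k} coprime⇔avoids = trans (φ≡count m) (count-cong _ (avoids? p k) m
  (λ y _ → ⇔.trans (mk⇔ Coprimality.gcd≡1⇒coprime Coprimality.coprime⇒gcd≡1) (coprime⇔avoids y)))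

φ-prodR-pow : ∀ {p} (e : ℕ → ℕ) k → IncreasingPrimes p k → (∀ i → 1 ≤ i → i ≤ k → 1 ≤ e i) →
              φ (prodR (λ i → p i ^ e i) k) ≡ prodR (λ i → p i ^ (e i ∸ 1)) k * prodR (λ i → p i ∸ 1) k
φ-prodR-pow {p} e k primes e≥1 = begin
  φ (prodR (λ i → p i ^ e i) k)                                     ≡⟨ φ≡count-avoids (coprime-prodR-pow⇔avoids e k prime e≥1) ⟩
  count (avoids? p k) (prodR (λ i → p i ^ e i) k)                   ≡⟨ cong (count (avoids? p k)) (prodR-pow-split p e k e≥1) ⟩
  count (avoids? p k) (prodR (λ i → p i ^ (e i ∸ 1)) k * prodR p k) ≡⟨ count-avoids k primes (prodR (λ i → p i ^ (e i ∸ 1)) k) ⟩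
  prodR (λ i → p i ^ (e i ∸ 1)) k * prodR (λ i → p i ∸ 1) k         ∎
  where
  open ≡-Reasoning
  open IncreasingPrimes primes

φ-prodR : ∀ {p} k → IncreasingPrimes p k → φ (prodR p k) ≡ prodR (λ i → p i ∸ 1) k
φ-prodR {p} k primes = begin
  φ (prodR p k)                       ≡⟨ φ≡count-avoids (λ y → coprime-prodR⇔avoids p p k (λ i 1≤i i≤k → coprime-prime⇔ (prime i 1≤i i≤k))) ⟩
  count (avoids? p k) (prodR p k)     ≡⟨ cong (count (avoids? p k)) (*-identityˡ (prodR p k)) ⟨
  count (avoids? p k) (1 * prodR p k) ≡⟨ count-avoids k primes 1 ⟩
  1 * prodR (λ i → p i ∸ 1) k         ≡⟨ *-identityˡ _ ⟩
  prodR (λ i → p i ∸ 1) k             ∎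
  where
  open ≡-Reasoning
  open IncreasingPrimes primes

-- With R = F + d and q = 1 + q′ the coefficient R + F·(q − 2) becomes d + F·q′, so β is a natural number.
+f+u*[R+F*[q-2]]≡ : ∀ f u R F q → F ≤ R → 1 ≤ q →
  + f ℤ.+ + u ℤ.* (+ R ℤ.+ + F ℤ.* (+ q ℤ.- + 2)) ≡ + (f + u * ((R ∸ F) + F * (q ∸ 1)))
+f+u*[R+F*[q-2]]≡ f u R F (suc q′) F≤R _ = begin
  + f ℤ.+ + u ℤ.* (+ R ℤ.+ + F ℤ.* (+ suc q′ ℤ.- + 2))
    ≡⟨ cong₂ (λ x y → + f ℤ.+ + u ℤ.* (x ℤ.+ + F ℤ.* (y ℤ.- + 2))) (trans (cong +_ (sym (m+[n∸m]≡n F≤R))) (pos-+ F d)) (pos-+ 1 q′) ⟩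
  + f ℤ.+ + u ℤ.* ((+ F ℤ.+ + d) ℤ.+ + F ℤ.* ((+ 1 ℤ.+ + q′) ℤ.- + 2))
    ≡⟨ simplify (+ f) (+ u) (+ F) (+ d) (+ q′) ⟩
  + f ℤ.+ + u ℤ.* (+ d ℤ.+ + F ℤ.* + q′)
    ≡⟨ cong (λ x → + f ℤ.+ + u ℤ.* (+ d ℤ.+ x)) (pos-* F q′) ⟨
  + f ℤ.+ + u ℤ.* (+ d ℤ.+ + (F * q′))
    ≡⟨ cong (λ x → + f ℤ.+ + u ℤ.* x) (pos-+ d (F * q′)) ⟨
  + f ℤ.+ + u ℤ.* + (d + F * q′)
    ≡⟨ cong (λ x → + f ℤ.+ x) (pos-* u (d + F * q′)) ⟨
  + f ℤ.+ + (u * (d + F * q′))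
    ≡⟨ pos-+ f (u * (d + F * q′)) ⟨
  + (f + u * (d + F * q′)) ∎
  where
  open ≡-Reasoning
  d : ℕ
  d = R ∸ F
  simplify : ∀ f u F d q′ → f ℤ.+ u ℤ.* ((F ℤ.+ d) ℤ.+ F ℤ.* ((+ 1 ℤ.+ q′) ℤ.- + 2)) ≡ f ℤ.+ u ℤ.* (d ℤ.+ F ℤ.* q′)
  simplify = ℤ-Solver.solve-∀

β≡+ : ∀ p e r a s → 1 ≤ p a ^ (s ∸ 1) →
  let n = N p e r ; P = rad p r ; q = p a ^ (s ∸ 1) ; R = P div p a
  in β p e r a s ≡ + (φ n + (n div (P * q)) * ((R ∸ φ R) + φ R * (q ∸ 1)))
β≡+ p e r a s q≥1 =
  +f+u*[R+F*[q-2]]≡ (φ (N p e r)) (N p e r div (rad p r * p a ^ (s ∸ 1))) (rad p r div p a) _ _ (φ[m]≤m _) q≥1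

q*X<Y+F*[q∸1] : ∀ {q X Y F} → 1 ≤ q → X < Y → X ≤ F → q * X < Y + F * (q ∸ 1)
q*X<Y+F*[q∸1] {suc q′} {X} {Y} {F} _ X<Y X≤F = +-mono-<-≤ X<Y (subst (q′ * X ≤_) (*-comm q′ F) (*-monoʳ-≤ q′ X≤F))

x*A∸[x∸1]*F≡A+[x∸1]*[A∸F] : ∀ x A F → 1 ≤ x → F ≤ A → x * A ∸ (x ∸ 1) * F ≡ A + (x ∸ 1) * (A ∸ F)
x*A∸[x∸1]*F≡A+[x∸1]*[A∸F] (suc x) A F _ F≤A = trans (+-∸-assoc A (*-monoʳ-≤ x F≤A)) (cong (_+_ A) (sym (*-distribˡ-∸ x A F)))

x*A∸[x∸1]*F-monoˡ-< : ∀ {a b A F} → 1 ≤ a → a < b → F < A → a * A ∸ (a ∸ 1) * F < b * A ∸ (b ∸ 1) * F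
x*A∸[x∸1]*F-monoˡ-< {a} {b} {A} {F} 1≤a a<b F<A = begin-strict
  a * A ∸ (a ∸ 1) * F   ≡⟨ x*A∸[x∸1]*F≡A+[x∸1]*[A∸F] a A F 1≤a (<⇒≤ F<A) ⟩
  A + (a ∸ 1) * (A ∸ F) <⟨ +-monoʳ-< A (*-monoˡ-< (A ∸ F) (∸-monoˡ-< a<b 1≤a)) ⟩
  A + (b ∸ 1) * (A ∸ F) ≡⟨ x*A∸[x∸1]*F≡A+[x∸1]*[A∸F] b A F (≤-trans 1≤a (<⇒≤ a<b)) (<⇒≤ F<A) ⟨
  b * A ∸ (b ∸ 1) * F   ∎
  where
  open ≤-Reasoning
  instance
    A∸F-nonZero : NonZero (A ∸ F)
    A∸F-nonZero = >-nonZero (m<n⇒0<n∸m F<A)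

∣-mod : ∀ {d n m} → d ∣ n → d ∣ m → d ∣ m mod n
∣-mod {n = zero}  _   d∣m = d∣m
∣-mod {n = suc n} d∣n d∣m = %-presˡ-∣ d∣m d∣n

∣-isPowerOf : ∀ {n x y d} → IsPowerOf n x y → d ∣ n → d ∣ toℕ y → d ∣ toℕ x
∣-isPowerOf {d = d} (k , x≡ky) d∣n d∣y = subst (d ∣_) (sym x≡ky) (∣-mod d∣n (∣n⇒∣m*n k d∣y))

-- An exponent k may be replaced by k % n, so a finite search decides it.
isPowerOf? : ∀ n (x y : Fin n) → Dec (IsPowerOf n x y)
isPowerOf? (suc n) x y = Dec.map′
  (λ (k , x≡ky) → toℕ k , x≡ky)
  (λ (k , x≡ky) → fromℕ< (m%n<n k (suc n)) , trans x≡ky (reduce k))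
  (any? λ k → toℕ x ℕ.≟ (toℕ k * toℕ y) % suc n)
  where
  reduce : ∀ k → (k * toℕ y) % suc n ≡ (toℕ (fromℕ< (m%n<n k (suc n))) * toℕ y) % suc n
  reduce k = begin
    (k * toℕ y) % suc n                              ≡⟨ %-distribˡ-* k (toℕ y) (suc n) ⟩
    (k % suc n * (toℕ y % suc n)) % suc n            ≡⟨ cong (λ j → (j * (toℕ y % suc n)) % suc n) (m%n%n≡m%n k (suc n)) ⟨
    (k % suc n % suc n * (toℕ y % suc n)) % suc n    ≡⟨ %-distribˡ-* (k % suc n) (toℕ y) (suc n) ⟨
    (k % suc n * toℕ y) % suc n                      ≡⟨ cong (λ j → (j * toℕ y) % suc n) (toℕ-fromℕ< (m%n<n k (suc n))) ⟨
    (toℕ (fromℕ< (m%n<n k (suc n))) * toℕ y) % suc n ∎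
    where open ≡-Reasoning

adj? : ∀ n (x y : Fin n) → Dec (Adj n x y)
adj? n x y = ¬? (x Fin.≟ y) ×-dec (isPowerOf? n x y ⊎-dec isPowerOf? n y x)

minimal-witness : ∀ {n ℓ} {P : Pred (Subset n) ℓ} → Decidable P → ∀ X → P X →
                  Σ[ Y ∈ Subset n ] (P Y × (∀ Z → P Z → ∣ Y ∣ ≤ ∣ Z ∣) × ∣ Y ∣ ≤ ∣ X ∣)
minimal-witness {n} {P = P} P? X PX = go X PX (<-wellFounded ∣ X ∣)
  where
  go : ∀ X → P X → Acc _<_ ∣ X ∣ → Σ[ Y ∈ Subset n ] (P Y × (∀ Z → P Z → ∣ Y ∣ ≤ ∣ Z ∣) × ∣ Y ∣ ≤ ∣ X ∣)
  go X PX (acc smaller) with anySubset? (λ Y → P? Y ×-dec (∣ Y ∣ <? ∣ X ∣))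
  ... | yes (Y , PY , Y<X) = let (W , PW , W-min , W≤Y) = go Y PY (smaller Y<X) in W , PW , W-min , ≤-trans W≤Y (<⇒≤ Y<X)
  ... | no ¬smaller        = X , PX , (λ Z PZ → ≮⇒≥ (λ Z<X → ¬smaller (Z , PZ , Z<X))) , ≤-refl

ClosedOutside : ∀ n → Subset n → Subset n → Set
ClosedOutside n Y S = ∀ a b → a ∈ S → b ∉ Y → Adj n a b → b ∈ S

-- Unlike the existence of a path, this certificate that Y is a cut-set is decidable by finite search.
Separates : ∀ n → Subset n → Set
Separates n Y = Σ[ u ∈ Fin n ] Σ[ v ∈ Fin n ] Σ[ S ∈ Subset n ] (u ∉ Y × v ∉ Y × u ∈ S × v ∉ S × ClosedOutside n Y S)

separates? : ∀ n → Decidable (Separates n)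
separates? n Y =
  any? λ u → any? λ v → anySubset? λ S →
    ¬? (u ∈? Y) ×-dec ¬? (v ∈? Y) ×-dec (u ∈? S) ×-dec ¬? (v ∈? S) ×-dec
    all? λ a → all? λ b → (a ∈? S) →-dec ¬? (b ∈? Y) →-dec adj? n a b →-dec (b ∈? S)

path-closed : ∀ {n Y S u w} → ClosedOutside n Y S → u ∈ S → Path n Y u w → w ∈ S
path-closed closed u∈S here                 = u∈S
path-closed closed u∈S (step adj v∉Y path) = path-closed closed (closed _ _ u∈S v∉Y adj) path

path-snoc : ∀ {n Y u a b} → Path n Y u a → Adj n a b → b ∉ Y → Path n Y u b
path-snoc here                adj b∉Y = step adj b∉Y here
path-snoc (step e v∉Y path) adj b∉Y = step e v∉Y (path-snoc path adj b∉Y)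

separates⇒cutSet : ∀ {n Y} → Separates n Y → IsCutSet n Y
separates⇒cutSet (u , v , S , u∉Y , v∉Y , u∈S , v∉S , closed) = u , v , u∉Y , v∉Y , v∉S ∘ path-closed closed u∈S

¬¬-decide-all : ∀ {n ℓ} (P : Fin n → Set ℓ) → ¬ ¬ (∀ i → Dec (P i))
¬¬-decide-all {zero}  P k = k λ ()
¬¬-decide-all {suc n} P k = ¬¬-excluded-middle λ P0? → ¬¬-decide-all (P ∘ Fin.suc) λ Psuc? →
  k λ { Fin.zero → P0? ; (Fin.suc i) → Psuc? i }

-- The set of vertices reachable from u is available only under a double negation, which the
-- decidability of Separates removes.
cutSet⇒separates : ∀ {n Y} → IsCutSet n Y → Separates n Y
cutSet⇒separates {n} {Y} (u , v , u∉Y , v∉Y , ¬path) = decidable-stable (separates? n Y) λ ¬separates →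
  ¬¬-decide-all (Path n Y u) λ reachable? →
    let S : Subset n
        S = tabulate (λ w → does (reachable? w))
        reached⁺ : ∀ {w} → Path n Y u w → w ∈ S
        reached⁺ {w} path = ∈-tabulate⁺ (Equivalence.from (does≡true⇔ (reachable? w)) path)
        reached⁻ : ∀ {w} → w ∈ S → Path n Y u w
        reached⁻ {w} w∈S = Equivalence.to (does≡true⇔ (reachable? w)) (∈-tabulate⁻ w∈S)
    in ¬separates (u , v , S , u∉Y , v∉Y , reached⁺ here , ¬path ∘ reached⁻ ,
                   λ a b a∈S b∉Y adj → reached⁺ (path-snoc (reached⁻ a∈S) adj b∉Y))

minimumCutSet : ∀ {n X} → IsCutSet n X → Σ[ Y ∈ Subset n ] (IsMinCutSet n Y × ∣ Y ∣ ≤ ∣ X ∣)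
minimumCutSet {n} {X} cut =
  let (Y , separatesY , Y-min , Y≤X) = minimal-witness (separates? n) X (cutSet⇒separates cut)
  in Y , (separates⇒cutSet separatesY , λ Z cutZ → Y-min Z (cutSet⇒separates cutZ)) , Y≤X

module Proposition3p4 (m : ℕ) (p e : ℕ → ℕ) (primes : IncreasingPrimes p (3 + m))
                      (e≥1 : ∀ i → 1 ≤ i → i ≤ 3 + m → 1 ≤ e i) where

  open IncreasingPrimes primes

  r n P T Q q t P/pᵣ P/p₁ X Y : ℕ
  r    = 3 + m
  n    = N p e r
  P    = rad p r
  T    = prodR (λ i → p i ^ (e i ∸ 1)) r
  Q    = p 1 ^ e 1
  q    = p 1 ^ (e 1 ∸ 1)
  t    = prodR (λ i → p (suc i) ^ (e (suc i) ∸ 1)) (2 + m)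
  P/pᵣ = prodR p (2 + m)
  P/p₁ = prodR (p ∘ suc) (2 + m)
  X    = P/pᵣ ∸ φ P/pᵣ
  Y    = P/p₁ ∸ φ P/p₁

  1≤r : 1 ≤ r
  1≤r = s≤s z≤n

  p-nonZero : ∀ i → 1 ≤ i → i ≤ r → NonZero (p i)
  p-nonZero i 1≤i i≤r = prime⇒nonZero (prime i 1≤i i≤r)

  p>0 : ∀ i → 1 ≤ i → i ≤ r → 0 < p i
  p>0 i 1≤i i≤r = >-nonZero⁻¹ (p i) {{p-nonZero i 1≤i i≤r}}

  instance
    p₁-nonZero : NonZero (p 1)
    p₁-nonZero = p-nonZero 1 ≤-refl 1≤r
    pᵣ-nonZero : NonZero (p r)
    pᵣ-nonZero = p-nonZero r 1≤r ≤-refl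
    P-nonZero : NonZero P
    P-nonZero = >-nonZero (prodR-positive r p>0)
    q-nonZero : NonZero q
    q-nonZero = m^n≢0 (p 1) (e 1 ∸ 1)
    Q-nonZero : NonZero Q
    Q-nonZero = m^n≢0 (p 1) (e 1)
    t-nonZero : NonZero t
    t-nonZero = >-nonZero (prodR-positive (2 + m) (λ i 1≤i i≤2+m → m^n>0 (p (suc i)) {{p-nonZero (suc i) (s≤s z≤n) (s≤s i≤2+m)}} (e (suc i) ∸ 1)))
    n-nonZero : NonZero n
    n-nonZero = >-nonZero (prodR-positive r (λ i 1≤i i≤r → m^n>0 (p i) {{p-nonZero i 1≤i i≤r}} (e i)))

  q≥1 : 1 ≤ q
  q≥1 = >-nonZero⁻¹ q

  primesⁱ : IncreasingPrimes p (2 + m)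
  primesⁱ = init (n≤1+n (2 + m))

  primesᵗ : IncreasingPrimes (p ∘ suc) (2 + m)
  primesᵗ = tail refl

  φ[P/pᵣ]≡ : φ P/pᵣ ≡ prodR (λ i → p i ∸ 1) (2 + m)
  φ[P/pᵣ]≡ = φ-prodR (2 + m) primesⁱ

  φ[P/p₁]≡ : φ P/p₁ ≡ prodR (λ i → p (suc i) ∸ 1) (2 + m)
  φ[P/p₁]≡ = φ-prodR (2 + m) primesᵗ

  n≡T*P : n ≡ T * P
  n≡T*P = prodR-pow-split p e r e≥1

  T≡q*t : T ≡ q * t
  T≡q*t = prodR-head _ (2 + m)

  Q≡p₁*q : Q ≡ p 1 * q
  Q≡p₁*q with e 1 | e≥1 1 ≤-refl 1≤r
  ... | suc e₁ | _ = refl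

  n≡Q*[t*P/p₁] : n ≡ Q * (t * P/p₁)
  n≡Q*[t*P/p₁] = trans (prodR-head _ (2 + m))
    (cong (Q *_) (prodR-pow-split (p ∘ suc) (e ∘ suc) (2 + m) (λ i 1≤i i≤2+m → e≥1 (suc i) (s≤s z≤n) (s≤s i≤2+m))))

  βᵣ≡ : β p e r r 1 ≡ + (φ n + T * X)
  βᵣ≡ = begin
    β p e r r 1
      ≡⟨ β≡+ p e r r 1 ≤-refl ⟩
    + (φ n + n div (P * 1) * (P div p r ∸ φ (P div p r) + φ (P div p r) * 0))
      ≡⟨ cong₂ (λ u R → + (φ n + u * (R ∸ φ R + φ R * 0))) n/P≡T (*-div-cancel P/pᵣ (p r)) ⟩
    + (φ n + T * (X + φ P/pᵣ * 0))
      ≡⟨ cong (λ z → + (φ n + T * z)) (trans (cong (_+_ X) (*-zeroʳ (φ P/pᵣ))) (+-identityʳ X)) ⟩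
    + (φ n + T * X) ∎
    where
    open ≡-Reasoning
    n/P≡T : n div (P * 1) ≡ T
    n/P≡T = trans (cong₂ _div_ n≡T*P (*-identityʳ P)) (*-div-cancel T P)

  β₁≡ : β p e r 1 (e 1) ≡ + (φ n + t * (Y + φ P/p₁ * (q ∸ 1)))
  β₁≡ = trans (β≡+ p e r 1 (e 1) q≥1) (cong₂ (λ u R → + (φ n + u * (R ∸ φ R + φ R * (q ∸ 1)))) n/[P*q]≡t P/p₁≡)
    where
    n/[P*q]≡t : n div (P * q) ≡ t
    n/[P*q]≡t = trans (cong (_div (P * q)) (trans n≡T*P (trans (cong (_* P) T≡q*t) (reorder q t P))))
                      (*-div-cancel t (P * q) {{m*n≢0 P q}})
      where
      reorder : ∀ q t P → q * t * P ≡ t * (P * q)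
      reorder = solve-∀
    P/p₁≡ : P div p 1 ≡ P/p₁
    P/p₁≡ = trans (cong (_div p 1) (trans (prodR-head p (2 + m)) (*-comm (p 1) P/p₁))) (*-div-cancel P/p₁ (p 1))

  X<Y : X < Y
  X<Y = begin-strict
    P/pᵣ ∸ φ P/pᵣ              ≡⟨ cong₂ _∸_ (prodR-head p (1 + m)) (trans φ[P/pᵣ]≡ (prodR-head _ (1 + m))) ⟩
    p 1 * A ∸ (p 1 ∸ 1) * Fᴬ   <⟨ x*A∸[x∸1]*F-monoˡ-< (p>0 1 ≤-refl 1≤r) (increasing 1 r ≤-refl (s≤s (s≤s z≤n)) ≤-refl) Fᴬ<A ⟩
    p r * A ∸ (p r ∸ 1) * Fᴬ   ≡⟨ cong₂ _∸_ (*-comm (p r) A) (trans (*-comm (p r ∸ 1) Fᴬ) (sym φ[P/p₁]≡)) ⟩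
    P/p₁ ∸ φ P/p₁              ∎
    where
    open ≤-Reasoning
    A Fᴬ : ℕ
    A  = prodR (p ∘ suc) (1 + m)
    Fᴬ = prodR (λ i → p (suc i) ∸ 1) (1 + m)
    Fᴬ<A : Fᴬ < A
    Fᴬ<A = prodR-pred<prodR m (λ i 1≤i i≤1+m → p>0 (suc i) (s≤s z≤n) (s≤s (m≤n⇒m≤1+n i≤1+m)))

  X≤φ[P/p₁] : X ≤ φ P/p₁
  X≤φ[P/p₁] = begin
    P/pᵣ ∸ φ P/pᵣ                       ≤⟨ m∸n≤m P/pᵣ (φ P/pᵣ) ⟩
    P/pᵣ                                ≤⟨ prodR-mono-≤ (2 + m) pᵢ≤pᵢ₊₁∸1 ⟩
    prodR (λ i → p (suc i) ∸ 1) (2 + m) ≡⟨ φ[P/p₁]≡ ⟨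
    φ P/p₁                              ∎
    where
    open ≤-Reasoning
    pᵢ≤pᵢ₊₁∸1 : ∀ i → 1 ≤ i → i ≤ 2 + m → p i ≤ p (suc i) ∸ 1
    pᵢ≤pᵢ₊₁∸1 i 1≤i i≤2+m = ∸-monoˡ-≤ 1 (increasing i (suc i) 1≤i ≤-refl (s≤s i≤2+m))

  βᵣ<β₁ : β p e r r 1 ℤ.< β p e r 1 (e 1)
  βᵣ<β₁ = subst₂ ℤ._<_ (sym βᵣ≡) (sym β₁≡) (ℤ.+<+ (+-monoʳ-< (φ n) (begin-strict
    T * X                      ≡⟨ cong (_* X) T≡q*t ⟩
    q * t * X                  ≡⟨ reorder q t X ⟩
    t * (q * X)                <⟨ *-monoʳ-< t (q*X<Y+F*[q∸1] q≥1 X<Y X≤φ[P/p₁]) ⟩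
    t * (Y + φ P/p₁ * (q ∸ 1)) ∎)))
    where
    open ≤-Reasoning
    reorder : ∀ q t X → q * t * X ≡ t * (q * X)
    reorder = solve-∀

  pᵢ∣n : ∀ i → 1 ≤ i → i ≤ r → p i ∣ n
  pᵢ∣n i 1≤i i≤r = ∣-trans (subst (_∣ p i ^ e i) (^-identityʳ (p i)) (^-∣-^ (p i) (e≥1 i 1≤i i≤r))) (∣-prodR _ r i 1≤i i≤r)

  pᵢ∤pⱼ : ∀ {i j} → 1 ≤ i → i ≤ r → 1 ≤ j → j ≤ r → i ≢ j → ¬ p i ∣ p j
  pᵢ∤pⱼ {i} {j} 1≤i i≤r 1≤j j≤r i≢j pᵢ∣pⱼ with <-cmp i j | prime∣prime⇒≡ (prime i 1≤i i≤r) (prime j 1≤j j≤r) pᵢ∣pⱼ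
  ... | tri< i<j _ _ | pᵢ≡pⱼ = <⇒≢ (increasing i j 1≤i i<j j≤r) pᵢ≡pⱼ
  ... | tri≈ _ i≡j _ | _     = i≢j i≡j
  ... | tri> _ _ j<i | pᵢ≡pⱼ = <⇒≢ (increasing j i 1≤j j<i i≤r) (sym pᵢ≡pⱼ)

  -- X₀ is Z_r^1 = E_n ∪ Q_r^1: E_n is the set of units, and x ∈ S_{n/(p_i p_r)} iff p_i p_r ∣ x.
  InX₀ : Pred ℕ 0ℓ
  InX₀ x = Avoids p r x ⊎ (p r ∣ x × ¬ Avoids p (2 + m) x)

  inX₀? : Decidable InX₀
  inX₀? = avoids? p r ∪? ((p r ∣?_) ∩? ∁? (avoids? p (2 + m)))

  X₀ : Subset n
  X₀ = tabulate (λ i → does (inX₀? (toℕ i)))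

  ∈X₀⇔ : ∀ {i} → i ∈ X₀ ⇔ InX₀ (toℕ i)
  ∈X₀⇔ {i} = mk⇔ (Equivalence.to (does≡true⇔ (inX₀? (toℕ i))) ∘ ∈-tabulate⁻)
                 (∈-tabulate⁺ ∘ Equivalence.from (does≡true⇔ (inX₀? (toℕ i))))

  Cᵣ : Pred ℕ 0ℓ
  Cᵣ x = p r ∣ x × Avoids p (2 + m) x

  Cᵣ-closed : ∀ a b → Cᵣ (toℕ a) → b ∉ X₀ → Adj n a b → Cᵣ (toℕ b)
  Cᵣ-closed a b (pᵣ∣a , a-avoids) b∉X₀ (_ , inj₁ a-power-of-b) = pᵣ∣b , b-avoids
    where
    b-avoids : Avoids p (2 + m) (toℕ b)
    b-avoids i 1≤i i≤2+m pᵢ∣b = a-avoids i 1≤i i≤2+m (∣-isPowerOf a-power-of-b (pᵢ∣n i 1≤i (m≤n⇒m≤1+n i≤2+m)) pᵢ∣b)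
    pᵣ∣b : p r ∣ toℕ b
    pᵣ∣b = decidable-stable (p r ∣? toℕ b) λ pᵣ∤b →
      b∉X₀ (Equivalence.from ∈X₀⇔ (inj₁ (Equivalence.from (bounded-∀-suc⇔ (2 + m)) (b-avoids , pᵣ∤b))))
  Cᵣ-closed a b (pᵣ∣a , _) b∉X₀ (_ , inj₂ b-power-of-a) = pᵣ∣b , b-avoids
    where
    pᵣ∣b : p r ∣ toℕ b
    pᵣ∣b = ∣-isPowerOf b-power-of-a (pᵢ∣n r 1≤r ≤-refl) pᵣ∣a
    b-avoids : Avoids p (2 + m) (toℕ b)
    b-avoids = decidable-stable (avoids? p (2 + m) (toℕ b)) λ ¬avoids →
      b∉X₀ (Equivalence.from ∈X₀⇔ (inj₂ (pᵣ∣b , ¬avoids)))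

  Cᵣ-path : ∀ {a w} → Cᵣ (toℕ a) → Path n X₀ a w → Cᵣ (toℕ w)
  Cᵣ-path Cᵣ[a] here                   = Cᵣ[a]
  Cᵣ-path Cᵣ[a] (step adj v∉X₀ path) = Cᵣ-path (Cᵣ-closed _ _ Cᵣ[a] v∉X₀ adj) path

  -- Opaque because type checking would otherwise unfold this proof while reducing toℕ (fromℕ< pᵣ<n).
  opaque
    pᵣ<n : p r < n
    pᵣ<n = begin-strict
      p r        <⟨ m<m*n (p r) P/pᵣ 1<P/pᵣ ⟩
      p r * P/pᵣ ≡⟨ *-comm (p r) P/pᵣ ⟩
      P          ≤⟨ ∣⇒≤ (divides T n≡T*P) ⟩
      n          ∎
      where
      open ≤-Reasoning
      1<P/pᵣ : 1 < P/pᵣ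
      1<P/pᵣ = <-≤-trans (nonTrivial⇒n>1 (p 1) {{prime⇒nonTrivial (prime 1 ≤-refl 1≤r)}})
                         (∣⇒≤ {{>-nonZero (prodR-positive (2 + m) (λ i 1≤i i≤2+m → p>0 i 1≤i (m≤n⇒m≤1+n i≤2+m)))}}
                              (∣-prodR p (2 + m) 1 ≤-refl (s≤s z≤n)))

  X₀-cutSet : IsCutSet n X₀
  X₀-cutSet = u , v , u∉X₀ , v∉X₀ , λ path → pᵣ∤p₁ (proj₁ (subst Cᵣ (toℕ-fromℕ< p₁<n) (Cᵣ-path Cᵣ[u] path)))
    where
    p₁<n : p 1 < n
    p₁<n = <-trans (increasing 1 r ≤-refl (s≤s (s≤s z≤n)) ≤-refl) pᵣ<n
    u v : Fin n
    u = fromℕ< pᵣ<n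
    v = fromℕ< p₁<n
    pᵣ∤p₁ : ¬ p r ∣ p 1
    pᵣ∤p₁ = pᵢ∤pⱼ 1≤r ≤-refl ≤-refl 1≤r (λ ())
    pᵣ-avoids : Avoids p (2 + m) (p r)
    pᵣ-avoids i 1≤i i≤2+m = pᵢ∤pⱼ 1≤i (m≤n⇒m≤1+n i≤2+m) 1≤r ≤-refl (<⇒≢ (s≤s i≤2+m))
    Cᵣ[u] : Cᵣ (toℕ u)
    Cᵣ[u] = subst Cᵣ (sym (toℕ-fromℕ< pᵣ<n)) (∣-refl , pᵣ-avoids)
    ¬InX₀[pᵣ] : ¬ InX₀ (p r)
    ¬InX₀[pᵣ] (inj₁ avoids)       = avoids r 1≤r ≤-refl ∣-refl
    ¬InX₀[pᵣ] (inj₂ (_ , ¬avoids)) = ¬avoids pᵣ-avoids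
    ¬InX₀[p₁] : ¬ InX₀ (p 1)
    ¬InX₀[p₁] (inj₁ avoids)     = avoids 1 ≤-refl 1≤r ∣-refl
    ¬InX₀[p₁] (inj₂ (pᵣ∣p₁ , _)) = pᵣ∤p₁ pᵣ∣p₁
    u∉X₀ : u ∉ X₀
    u∉X₀ = ¬InX₀[pᵣ] ∘ subst InX₀ (toℕ-fromℕ< pᵣ<n) ∘ Equivalence.to ∈X₀⇔
    v∉X₀ : v ∉ X₀
    v∉X₀ = ¬InX₀[p₁] ∘ subst InX₀ (toℕ-fromℕ< p₁<n) ∘ Equivalence.to ∈X₀⇔

  ∣X₀∣≡ : ∣ X₀ ∣ ≡ φ n + T * X
  ∣X₀∣≡ = begin
    ∣ X₀ ∣
      ≡⟨ ∣tabulate∣ {n = n} inX₀? ⟩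
    count inX₀? n
      ≡⟨ count-∪ (avoids? p r) _ n (λ x _ avoids (pᵣ∣x , _) → avoids r 1≤r ≤-refl pᵣ∣x) ⟩
    count (avoids? p r) n + count ((p r ∣?_) ∩? ∁? (avoids? p (2 + m))) n
      ≡⟨ cong₂ (λ a b → a + count ((p r ∣?_) ∩? ∁? (avoids? p (2 + m))) b) (sym φn≡count) n≡pᵣ*[T*P/pᵣ] ⟩
    φ n + count ((p r ∣?_) ∩? ∁? (avoids? p (2 + m))) (p r * (T * P/pᵣ))
      ≡⟨ cong (_+_ (φ n)) (count-multiples-invariant (p r) (∁? (avoids? p (2 + m))) (T * P/pᵣ) (λ y → ¬-cong (avoids-*⇔ pᵢ⊥pᵣ))) ⟩
    φ n + count (∁? (avoids? p (2 + m))) (T * P/pᵣ)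
      ≡⟨ cong (_+_ (φ n)) (count-∁ (avoids? p (2 + m)) (T * P/pᵣ)) ⟩
    φ n + (T * P/pᵣ ∸ count (avoids? p (2 + m)) (T * P/pᵣ))
      ≡⟨ cong (λ c → φ n + (T * P/pᵣ ∸ c)) (trans (count-avoids (2 + m) primesⁱ T) (cong (T *_) (sym φ[P/pᵣ]≡))) ⟩
    φ n + (T * P/pᵣ ∸ T * φ P/pᵣ)
      ≡⟨ cong (_+_ (φ n)) (*-distribˡ-∸ T P/pᵣ (φ P/pᵣ)) ⟨
    φ n + T * X ∎
    where
    open ≡-Reasoning
    φn≡count : φ n ≡ count (avoids? p r) n
    φn≡count = φ≡count-avoids (coprime-prodR-pow⇔avoids e r prime e≥1)
    n≡pᵣ*[T*P/pᵣ] : n ≡ p r * (T * P/pᵣ)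
    n≡pᵣ*[T*P/pᵣ] = trans n≡T*P (reorder T P/pᵣ (p r))
      where
      reorder : ∀ T R a → T * (R * a) ≡ a * (T * R)
      reorder = solve-∀
    pᵢ⊥pᵣ : ∀ i → 1 ≤ i → i ≤ 2 + m → Coprime (p i) (p r)
    pᵢ⊥pᵣ i 1≤i i≤2+m = Equivalence.from (coprime-prime⇔ (prime r 1≤r ≤-refl))
      (pᵢ∤pⱼ 1≤r ≤-refl 1≤i (m≤n⇒m≤1+n i≤2+m) (<⇒≢ (s≤s i≤2+m) ∘ sym))

  ∣X₀∣<β₁ : + ∣ X₀ ∣ ℤ.< β p e r 1 (e 1)
  ∣X₀∣<β₁ = subst (ℤ._< β p e r 1 (e 1)) (trans βᵣ≡ (cong +_ (sym ∣X₀∣≡))) βᵣ<β₁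

  Avoidsᵗ : Pred ℕ 0ℓ
  Avoidsᵗ = Avoids (p ∘ suc) (2 + m)

  avoidsᵗ? : Decidable Avoidsᵗ
  avoidsᵗ? = avoids? (p ∘ suc) (2 + m)

  count-avoidsᵗ : ∀ K → count avoidsᵗ? (K * P/p₁) ≡ K * φ P/p₁
  count-avoidsᵗ K = trans (count-avoids (2 + m) primesᵗ K) (cong (K *_) (sym φ[P/p₁]≡))

  pᵢ₊₁⊥Q : ∀ i → 1 ≤ i → i ≤ 2 + m → Coprime (p (suc i)) Q
  pᵢ₊₁⊥Q i 1≤i i≤2+m = Equivalence.from (⇔.trans (coprime-^⇔ (e≥1 1 ≤-refl 1≤r)) (coprime-prime⇔ (prime 1 ≤-refl 1≤r)))
    (pᵢ∤pⱼ ≤-refl 1≤r (s≤s z≤n) (s≤s i≤2+m) (<⇒≢ (s≤s 1≤i)))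

  Q-invariance : ∀ {y} → Avoidsᵗ (Q * y) ⇔ Avoidsᵗ y
  Q-invariance = avoids-*⇔ pᵢ₊₁⊥Q

  Q∣n : Q ∣ n
  Q∣n = ∣-prodR _ r 1 ≤-refl 1≤r

  -- D₁ ⊆ E_n ∪ E_{n/p₁} ∪ ⋯ ∪ E_{n/p₁^{n₁−1}} and D₂ ⊆ Q_1^{n₁}.
  D₁ D₂ : Pred ℕ 0ℓ
  D₁ x = ¬ Q ∣ x × Avoidsᵗ x
  D₂ x = Q ∣ x × ¬ Avoidsᵗ x

  D₁? : Decidable D₁
  D₁? = ∁? (Q ∣?_) ∩? avoidsᵗ?

  D₂? : Decidable D₂
  D₂? = (Q ∣?_) ∩? ∁? avoidsᵗ?

  ∈Z-by-order : ∀ i j → j < e 1 → ord n i ≡ n div (p 1 ^ j) → Bool.T (inZ p e r 1 (e 1) i)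
  ∈Z-by-order i j j<e₁ ord≡ = Equivalence.from (T-∨ {x = any (λ j → ord n i ℕ.≡ᵇ (n div (p 1 ^ j))) (upTo (e 1))})
    (inj₁ (any⁺ (λ j → ord n i ℕ.≡ᵇ (n div (p 1 ^ j))) (lose (∈-upTo⁺ j<e₁) (≡⇒≡ᵇ _ _ ord≡))))

  ∈Z-by-divisor : ∀ i k → 2 ≤ k → k ≤ r → ord n i ∣ n div (p k * Q) → Bool.T (inZ p e r 1 (e 1) i)
  ∈Z-by-divisor i k (s≤s (s≤s _)) k≤r ord∣ = Equivalence.from (T-∨ {x = any (λ j → ord n i ℕ.≡ᵇ (n div (p 1 ^ j))) (upTo (e 1))})
    (inj₂ (any⁺ (λ k → Bool.not (k ℕ.≡ᵇ 1) Bool.∧ ⌊ ord n i ∣? (n div (p k * Q)) ⌋) (lose (∈-applyUpTo⁺ suc k≤r) (fromWitness ord∣))))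

  -- Writing x = p₁^j·z with p₁ ∤ z, the factor z is a unit, so gcd x n = p₁^j.
  D₁⊆Z : ∀ i → D₁ (toℕ i) → Bool.T (inZ p e r 1 (e 1) i)
  D₁⊆Z i (¬Q∣x , x-avoids) with split-prime-power (p 1) (e 1) (toℕ i) ¬Q∣x
  ... | j , j<e₁ , z , x≡p₁^j*z , p₁∤z = ∈Z-by-order i j j<e₁ (cong (n div_) gcd≡)
    where
    z-avoids : Avoids p r z
    z-avoids = Equivalence.from (bounded-∀-head⇔ (2 + m)) (p₁∤z , λ k 1≤k k≤2+m →
      x-avoids k 1≤k k≤2+m ∘ subst (p (suc k) ∣_) (sym x≡p₁^j*z) ∘ ∣n⇒∣m*n (p 1 ^ j))
    gcd≡ : gcd (toℕ i) n ≡ p 1 ^ j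
    gcd≡ = trans (cong (λ x → gcd x n) x≡p₁^j*z)
      (gcd[c*z,n]≡c (∣-trans (^-∣-^ (p 1) (<⇒≤ j<e₁)) Q∣n) (Equivalence.from (coprime-prodR-pow⇔avoids e r prime e≥1 z) z-avoids))

  -- If p_{k+1} ∣ x then p_{k+1}·Q divides gcd x n, so ord x ∣ n/(p_{k+1}·Q).
  D₂⊆Z : ∀ i → D₂ (toℕ i) → Bool.T (inZ p e r 1 (e 1) i)
  D₂⊆Z i (Q∣x , ¬avoids) with ¬avoids⇒∣ (p ∘ suc) (2 + m) (toℕ i) ¬avoids
  ... | k , 1≤k , k≤2+m , pₖ₊₁∣x = ∈Z-by-divisor i (suc k) (s≤s 1≤k) (s≤s k≤2+m)
    (div-∣-div (ℕ.≢-nonZero⁻¹ n) (gcd-greatest pₖ₊₁Q∣x pₖ₊₁Q∣n) (gcd[m,n]∣n (toℕ i) n))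
    where
    pₖ₊₁Q∣x : p (suc k) * Q ∣ toℕ i
    pₖ₊₁Q∣x = coprime-∣-* (pᵢ₊₁⊥Q k 1≤k k≤2+m) pₖ₊₁∣x Q∣x
    pₖ₊₁Q∣n : p (suc k) * Q ∣ n
    pₖ₊₁Q∣n = coprime-∣-* (pᵢ₊₁⊥Q k 1≤k k≤2+m) (pᵢ∣n (suc k) (s≤s z≤n) (s≤s k≤2+m)) Q∣n

  count-D₁ : count D₁? n ≡ φ n + t * (φ P/p₁ * (q ∸ 1))
  count-D₁ = begin
    count (∁? (Q ∣?_) ∩? avoidsᵗ?) n
      ≡⟨ cong (count (∁? (Q ∣?_) ∩? avoidsᵗ?)) n≡Q*[t*P/p₁] ⟩
    count (∁? (Q ∣?_) ∩? avoidsᵗ?) (Q * (t * P/p₁))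
      ≡⟨ count-non-multiples-invariant Q avoidsᵗ? (t * P/p₁) (λ _ → Q-invariance) ⟩
    count avoidsᵗ? (Q * (t * P/p₁)) ∸ count avoidsᵗ? (t * P/p₁)
      ≡⟨ cong₂ _∸_ (trans (cong (count avoidsᵗ?) (sym (*-assoc Q t P/p₁))) (count-avoidsᵗ (Q * t))) (count-avoidsᵗ t) ⟩
    Q * t * F ∸ t * F
      ≡⟨ cong₂ _∸_ (*-assoc Q t F) (sym (*-identityˡ (t * F))) ⟩
    Q * (t * F) ∸ 1 * (t * F)
      ≡⟨ *-distribʳ-∸ (t * F) Q 1 ⟨
    (Q ∸ 1) * (t * F)
      ≡⟨ cong (λ c → (c ∸ 1) * (t * F)) Q≡p₁*q ⟩
    (p 1 * q ∸ 1) * (t * F)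
      ≡⟨ cong (_* (t * F)) (a*q∸1≡q*[a∸1]+[q∸1] (p>0 1 ≤-refl 1≤r) q≥1) ⟩
    (q * (p 1 ∸ 1) + (q ∸ 1)) * (t * F)
      ≡⟨ reorder q (p 1 ∸ 1) (q ∸ 1) t F ⟩
    q * t * ((p 1 ∸ 1) * F) + t * (F * (q ∸ 1))
      ≡⟨ cong (_+ t * (F * (q ∸ 1))) φn≡ ⟨
    φ n + t * (F * (q ∸ 1)) ∎
    where
    open ≡-Reasoning
    F : ℕ
    F = φ P/p₁
    φn≡ : φ n ≡ q * t * ((p 1 ∸ 1) * F)
    φn≡ = trans (φ-prodR-pow e r primes e≥1) (cong₂ _*_ T≡q*t (trans (prodR-head _ (2 + m)) (cong ((p 1 ∸ 1) *_) (sym φ[P/p₁]≡))))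
    a*q∸1≡q*[a∸1]+[q∸1] : ∀ {a q} → 0 < a → 1 ≤ q → a * q ∸ 1 ≡ q * (a ∸ 1) + (q ∸ 1)
    a*q∸1≡q*[a∸1]+[q∸1] {suc a} {suc q} _ _ = rearrange a q
      where
      rearrange : ∀ a q → q + a * suc q ≡ suc q * a + q
      rearrange = solve-∀
    reorder : ∀ q a′ q′ t F → (q * a′ + q′) * (t * F) ≡ q * t * (a′ * F) + t * (F * q′)
    reorder = solve-∀

  count-D₂ : count D₂? n ≡ t * Y
  count-D₂ = begin
    count ((Q ∣?_) ∩? ∁? avoidsᵗ?) n                ≡⟨ cong (count ((Q ∣?_) ∩? ∁? avoidsᵗ?)) n≡Q*[t*P/p₁] ⟩
    count ((Q ∣?_) ∩? ∁? avoidsᵗ?) (Q * (t * P/p₁)) ≡⟨ count-multiples-invariant Q (∁? avoidsᵗ?) (t * P/p₁) (λ _ → ¬-cong Q-invariance) ⟩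
    count (∁? avoidsᵗ?) (t * P/p₁)                  ≡⟨ count-∁ avoidsᵗ? (t * P/p₁) ⟩
    t * P/p₁ ∸ count avoidsᵗ? (t * P/p₁)            ≡⟨ cong (t * P/p₁ ∸_) (count-avoidsᵗ t) ⟩
    t * P/p₁ ∸ t * φ P/p₁                           ≡⟨ *-distribˡ-∸ t P/p₁ (φ P/p₁) ⟨
    t * Y                                           ∎
    where open ≡-Reasoning

  β₁≤∣Z∣ : β p e r 1 (e 1) ℤ.≤ + ∣ Z p e r 1 (e 1) ∣
  β₁≤∣Z∣ = subst (ℤ._≤ + ∣ Z p e r 1 (e 1) ∣) (sym β₁≡) (ℤ.+≤+ (begin
    φ n + t * (Y + φ P/p₁ * (q ∸ 1))
      ≡⟨ regroup (φ n) t Y (φ P/p₁ * (q ∸ 1)) ⟩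
    φ n + t * (φ P/p₁ * (q ∸ 1)) + t * Y
      ≡⟨ cong₂ _+_ count-D₁ count-D₂ ⟨
    count D₁? n + count D₂? n
      ≡⟨ count-∪ D₁? D₂? n (λ _ _ (¬Q∣x , _) (Q∣x , _) → ¬Q∣x Q∣x) ⟨
    count (D₁? ∪? D₂?) n
      ≤⟨ count≤∣tabulate∣ (D₁? ∪? D₂?) (inZ p e r 1 (e 1)) (λ i → [ D₁⊆Z i , D₂⊆Z i ]′) ⟩
    ∣ Z p e r 1 (e 1) ∣ ∎))
    where
    open ≤-Reasoning
    regroup : ∀ a t Y c → a + t * (Y + c) ≡ a + t * c + t * Y
    regroup = solve-∀

  minCutSet<β₁ : Σ[ X ∈ Subset n ] (IsMinCutSet n X × + ∣ X ∣ ℤ.< β p e r 1 (e 1))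
  minCutSet<β₁ = let (X , X-min , X≤X₀) = minimumCutSet X₀-cutSet in X , X-min , ℤₚ.≤-<-trans (ℤ.+≤+ X≤X₀) ∣X₀∣<β₁

  Z-not-minCutSet : ¬ IsMinCutSet n (Z p e r 1 (e 1))
  Z-not-minCutSet (_ , Z-min) = ℤₚ.<-irrefl refl (ℤₚ.≤-<-trans (ℤₚ.≤-trans β₁≤∣Z∣ (ℤ.+≤+ (Z-min X₀ X₀-cutSet))) ∣X₀∣<β₁)

proposition3p4 : (r : ℕ) (p e : ℕ → ℕ) →
    3 ≤ r →
    (∀ i → 1 ≤ i → i ≤ r → Prime (p i)) →
    (∀ i j → 1 ≤ i → i < j → j ≤ r → p i < p j) →
    (∀ i → 1 ≤ i → i ≤ r → 1 ≤ e i) →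
    (β p e r r 1 ℤ.< β p e r 1 (e 1))
    × (Σ[ X ∈ Subset (N p e r) ] (IsMinCutSet (N p e r) X × (+ ∣ X ∣) ℤ.< β p e r 1 (e 1)))
    × ¬ IsMinCutSet (N p e r) (Z p e r 1 (e 1))
proposition3p4 (suc (suc (suc m))) p e (s≤s (s≤s (s≤s _))) prime increasing e≥1 =
  βᵣ<β₁ , minCutSet<β₁ , Z-not-minCutSet
  where open Proposition3p4 m p e (mkIncreasingPrimes prime increasing) e≥1
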